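{- For every $n\ge1$, \[ \mu_n=\sum_{j=1}^nS(n,j)\,(b)_j\,d^j, \] where $S(n,j)$ are Stirling numbers of the second kind and $(b)_j=b(b+1)\cdots(b+j-1)$.
   Context: Let $b,d$ be indeterminates and set $b_n=n-dn+bd-d$, $a_n=nd$, $\lambda_n=bdn-dn^2$ for $n\ge0$. A Motzkin–Schröder path is a lattice path never going below the $x$-axis with steps up $(1,1)$, horizontal $(1,0)$, vertical down $(0,-1)$, diagonal down $(1,-1)$; its weight is the product of step weights, where up steps have weight $1$, a horizontal step starting at height $h$ has weight $b_h$, a vertical down step starting at height $h$ has weight $a_h$, and a diagonal down step starting at height $h$ has weight $\lambda_h$. Here $\mu_n$ is the sum of the weights of all Motzkin–Schröder paths from $(0,0)$ to $(n,0)$; this equals the moment $\mathcal{L}(x^n)$ of the type $R_I$ orthogonal polynomials $P_{n+1}(x)=(x-b_n)P_n(x)-(a_nx+\lambda_n)P_{n-1}(x)$ (the type $R_I$ Meixner polynomials, with $d=c/(1-c)$). -}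

module Defs where

open import Level using (Level)
open import Data.Nat as ℕ using (ℕ; zero; suc)
open import Data.List using (List; []; _∷_; [_]; map; _++_)
open import Algebra.Bundles using (CommutativeRing; Semiring)
import Algebra.Definitions.RawSemiring as RawSemiringDefs

S₂ : ℕ → ℕ → ℕ
S₂ zero    zero    = 1
S₂ zero    (suc k) = 0
S₂ (suc n) zero    = 0
S₂ (suc n) (suc k) = suc k ℕ.* S₂ n (suc k) ℕ.+ S₂ n k

-- MSPath k h : paths starting at height h,
-- of horizontal length k, ending at height 0, never going below the
-- x-axis (heights are natural numbers; down steps only start from
-- a positive height).  Constructors are the FIRST step of the path.
data MSPath : ℕ → ℕ → Set where
  end  : MSPath 0 0
  up   : ∀ {k h} → MSPath k (suc h) → MSPath (suc k) h
  hor  : ∀ {k h} → MSPath k h → MSPath (suc k) h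
  vert : ∀ {k h} → MSPath k h → MSPath k (suc h)        -- step (0,-1)
  diag : ∀ {k h} → MSPath k h → MSPath (suc k) (suc h)  -- step (1,-1)

allPaths : (k h : ℕ) → List (MSPath k h)
allPaths zero    zero    = [ end ]
allPaths zero    (suc h) = map vert (allPaths zero h)
allPaths (suc k) zero    = map up (allPaths k 1) ++ map hor (allPaths k zero)
allPaths (suc k) (suc h) =
  map up (allPaths k (suc (suc h))) ++ map hor (allPaths k (suc h)) ++
  map vert (allPaths (suc k) h) ++ map diag (allPaths k h)

module MeixnerRI {c ℓ : Level} (R : CommutativeRing c ℓ) where
  open CommutativeRing R
  open RawSemiringDefs (Semiring.rawSemiring semiring) using (_×_; _^_)

  ι : ℕ → Carrier
  ι n = n × 1#

  module _ (b d : Carrier) where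
    bₙ : ℕ → Carrier
    bₙ n = ι n - d * ι n + b * d - d
    aₙ : ℕ → Carrier
    aₙ n = ι n * d
    λₙ : ℕ → Carrier
    λₙ n = b * d * ι n - d * (ι n * ι n)

    weight : ∀ {k h} → MSPath k h → Carrier
    weight end = 1#
    weight (up p) = weight p
    weight {h = h} (hor p) = bₙ h * weight p
    weight {h = suc h} (vert p) = aₙ (suc h) * weight p
    weight {h = suc h} (diag p) = λₙ (suc h) * weight p

    sumR : List Carrier → Carrier
    sumR [] = 0#
    sumR (x ∷ xs) = x + sumR xs

    μ : ℕ → Carrier
    μ n = sumR (map weight (allPaths n 0))

    rising : ℕ → Carrier
    rising zero = 1#
    rising (suc j) = rising j * (b + ι j)

    Σ₁ : ℕ → (ℕ → Carrier) → Carrier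
    Σ₁ zero f = 0#
    Σ₁ (suc m) f = Σ₁ m f + f (suc m)

    rhs : ℕ → Carrier
    rhs n = Σ₁ n (λ j → ι (S₂ n j) * rising j * d ^ j)

-- Let F(k,h) be the total weight of the paths of length k from height h down to the axis, so that
-- μ n = F(n,0), and decompose each path by its first step.  Put (Δ g)(m) = g(m+1) + m g(m) and
-- G_h(m) = (b)_m E(m,h), where E(m,h) is h! times a d-weighted Delannoy number.  The exchange
-- relation E(m,h+1) + h E(m,h) = (m+1) E(m+1,h) + m E(m,h) shows that Δ G_h obeys the first-step
-- recurrence of F, so F(k,h) = (Δᵏ G_h)(0) by induction.  Finally (Δᵏ g)(0) is the Stirling
-- transform Σ_j S(k,j) g(j), and G_0(j) = (b)_j d^j.

module Submission where

open import Defs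
open import Level using (Level)
open import Data.Nat using (ℕ; _≥_)
open import Algebra.Bundles using (CommutativeRing)

open import Algebra.Bundles using (CommutativeSemiring; RawRing; Ring; Semiring)
open import Data.Nat as ℕ using (zero; suc)
import Data.Nat.Properties as ℕ
open import Data.Integer as ℤ using (ℤ; +_; -[1+_]; _⊖_)
import Data.Integer.Properties as ℤ
open import Data.Sign as Sign using (Sign)
open import Data.Maybe using (Maybe; just; nothing)
open import Relation.Binary.PropositionalEquality as ≡ using (_≡_)
open import Relation.Nullary using (yes; no)
import Algebra.Solver.Ring.AlmostCommutativeRing as AlmostCommutativeRing

module IntegerCoefficientSolver {c ℓ : Level} (R : CommutativeRing c ℓ) where
  open CommutativeRing R hiding (zero)
  open import Algebra.Properties.Semiring.Mult.TCOptimised semiring using (_×_; 1+×; ×-homo-+; ×1-homo-*)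
  open import Algebra.Properties.RingWithoutOne (Ring.ringWithoutOne ring) using (-‿distribˡ-*; -‿distribʳ-*)
  open import Algebra.Properties.AbelianGroup +-abelianGroup using (⁻¹-∙-comm; xyx⁻¹≈y)
  open import Algebra.Properties.Group +-group using (⁻¹-involutive; ε⁻¹≈ε)
  open import Relation.Binary.Reasoning.Setoid setoid

  -- The optimised _×_ makes ⟦ + 1 ⟧ reduce to 1#, so that solver expressions such as
  -- con (+ 1) :+ m evaluate definitionally to the ι (suc m) = 1# + ι m of Defs.
  ⟦_⟧ : ℤ → Carrier
  ⟦ + n ⟧ = n × 1#
  ⟦ -[1+ n ] ⟧ = - (suc n × 1#)

  [x+y]-[x+z]≈y-z : ∀ x y z → (x + y) - (x + z) ≈ y - z
  [x+y]-[x+z]≈y-z x y z = begin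
    (x + y) - (x + z)        ≈⟨ +-congˡ (⁻¹-∙-comm x z) ⟨
    (x + y) + (- x + - z)    ≈⟨ +-assoc _ _ _ ⟨
    (x + y - x) - z          ≈⟨ +-congʳ (xyx⁻¹≈y x y) ⟩
    y - z                    ∎

  ⊖-homo : ∀ m n → ⟦ m ⊖ n ⟧ ≈ m × 1# - n × 1#
  ⊖-homo zero zero = sym (trans (+-congˡ ε⁻¹≈ε) (+-identityʳ 0#))
  ⊖-homo zero (suc n) = sym (+-identityˡ _)
  ⊖-homo (suc m) zero = sym (trans (+-congˡ ε⁻¹≈ε) (+-identityʳ _))
  ⊖-homo (suc m) (suc n) = begin
    ⟦ suc m ⊖ suc n ⟧                  ≡⟨ ≡.cong ⟦_⟧ (ℤ.[1+m]⊖[1+n]≡m⊖n m n) ⟩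
    ⟦ m ⊖ n ⟧                          ≈⟨ ⊖-homo m n ⟩
    m × 1# - n × 1#                    ≈⟨ [x+y]-[x+z]≈y-z 1# _ _ ⟨
    (1# + m × 1#) - (1# + n × 1#)      ≈⟨ +-cong (1+× m 1#) (-‿cong (1+× n 1#)) ⟨
    suc m × 1# - suc n × 1#            ∎

  +-homo : ∀ i j → ⟦ i ℤ.+ j ⟧ ≈ ⟦ i ⟧ + ⟦ j ⟧
  +-homo (+ m) (+ n) = ×-homo-+ 1# m n
  +-homo (+ m) -[1+ n ] = ⊖-homo m (suc n)
  +-homo -[1+ m ] (+ n) = trans (⊖-homo n (suc m)) (+-comm _ _)
  +-homo -[1+ m ] -[1+ n ] = begin
    - (suc (suc (m ℕ.+ n)) × 1#)         ≡⟨ ≡.cong (λ k → - (suc k × 1#)) (ℕ.+-suc m n) ⟨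
    - ((suc m ℕ.+ suc n) × 1#)           ≈⟨ -‿cong (×-homo-+ 1# (suc m) (suc n)) ⟩
    - (suc m × 1# + suc n × 1#)          ≈⟨ ⁻¹-∙-comm _ _ ⟨
    - (suc m × 1#) + - (suc n × 1#)      ∎

  -‿homo : ∀ i → ⟦ ℤ.- i ⟧ ≈ - ⟦ i ⟧
  -‿homo (+ zero) = sym ε⁻¹≈ε
  -‿homo (+ suc n) = refl
  -‿homo -[1+ n ] = sym (⁻¹-involutive _)

  signed : Sign → Carrier → Carrier
  signed Sign.+ x = x
  signed Sign.- x = - x

  signed-cong : ∀ s {x y} → x ≈ y → signed s x ≈ signed s y
  signed-cong Sign.+ p = p
  signed-cong Sign.- p = -‿cong p

  ◃-homo : ∀ s n → ⟦ s ℤ.◃ n ⟧ ≈ signed s (n × 1#)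
  ◃-homo Sign.+ zero = refl
  ◃-homo Sign.- zero = sym ε⁻¹≈ε
  ◃-homo Sign.+ (suc n) = refl
  ◃-homo Sign.- (suc n) = refl

  ⟦⟧-sign-abs : ∀ i → ⟦ i ⟧ ≈ signed (ℤ.sign i) (ℤ.∣ i ∣ × 1#)
  ⟦⟧-sign-abs (+ n) = refl
  ⟦⟧-sign-abs -[1+ n ] = refl

  signed-* : ∀ s t x y → signed (s Sign.* t) (x * y) ≈ signed s x * signed t y
  signed-* Sign.+ Sign.+ x y = refl
  signed-* Sign.+ Sign.- x y = -‿distribʳ-* x y
  signed-* Sign.- Sign.+ x y = -‿distribˡ-* x y
  signed-* Sign.- Sign.- x y = begin
    x * y          ≈⟨ ⁻¹-involutive _ ⟨
    - - (x * y)    ≈⟨ -‿cong (-‿distribˡ-* x y) ⟩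
    - (- x * y)    ≈⟨ -‿distribʳ-* (- x) y ⟩
    - x * - y      ∎

  *-homo : ∀ i j → ⟦ i ℤ.* j ⟧ ≈ ⟦ i ⟧ * ⟦ j ⟧
  *-homo i j = begin
    ⟦ (s Sign.* t) ℤ.◃ (m ℕ.* n) ⟧                 ≈⟨ ◃-homo (s Sign.* t) (m ℕ.* n) ⟩
    signed (s Sign.* t) ((m ℕ.* n) × 1#)           ≈⟨ signed-cong (s Sign.* t) (×1-homo-* m n) ⟩
    signed (s Sign.* t) (m × 1# * n × 1#)          ≈⟨ signed-* s t _ _ ⟩
    signed s (m × 1#) * signed t (n × 1#)          ≈⟨ *-cong (⟦⟧-sign-abs i) (⟦⟧-sign-abs j) ⟨
    ⟦ i ⟧ * ⟦ j ⟧                                  ∎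
    where
    s t : Sign
    s = ℤ.sign i
    t = ℤ.sign j
    m n : ℕ
    m = ℤ.∣ i ∣
    n = ℤ.∣ j ∣

  ℤ-rawRing : RawRing _ _
  ℤ-rawRing = record
    { Carrier = ℤ ; _≈_ = _≡_ ; _+_ = ℤ._+_ ; _*_ = ℤ._*_ ; -_ = ℤ.-_ ; 0# = + 0 ; 1# = + 1 }

  ⟦⟧-homomorphism : AlmostCommutativeRing._-Raw-AlmostCommutative⟶_ ℤ-rawRing
                      (AlmostCommutativeRing.fromCommutativeRing R)
  ⟦⟧-homomorphism = record
    { ⟦_⟧ = ⟦_⟧ ; +-homo = +-homo ; *-homo = *-homo ; -‿homo = -‿homo ; 0-homo = refl ; 1-homo = refl }

  ⟦⟧-weaklyDecidable : ∀ i j → Maybe (⟦ i ⟧ ≈ ⟦ j ⟧)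
  ⟦⟧-weaklyDecidable i j with i ℤ.≟ j
  ... | yes ≡.refl = just refl
  ... | no _ = nothing

  open import Algebra.Solver.Ring ℤ-rawRing (AlmostCommutativeRing.fromCommutativeRing R)
    ⟦⟧-homomorphism ⟦⟧-weaklyDecidable public
    using (solve; _:=_; _:+_; _:*_; _:-_; con)

S₂-vanishes : ∀ {n k} → n ℕ.< k → S₂ n k ≡ 0
S₂-vanishes {zero} {suc k} _ = ≡.refl
S₂-vanishes {suc n} {suc k} (ℕ.s≤s n<k)
  rewrite S₂-vanishes (ℕ.m≤n⇒m≤1+n n<k) | S₂-vanishes n<k = ≡.trans (ℕ.+-identityʳ _) (ℕ.*-zeroʳ k)

module StirlingTransform {c ℓ : Level} (S : CommutativeSemiring c ℓ) where
  open CommutativeSemiring S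
  open import Algebra.Definitions.RawSemiring rawSemiring using (_×_)
  open import Algebra.Properties.Semiring.Mult semiring using (×1-homo-*; ×-homo-+)
  open import Algebra.Properties.Semiring.Sum semiring
    using (sum; sum-init-last; sum-cong-≗; sum-cong-≋; ∑-distrib-+)
  open import Algebra.Solver.Ring.NaturalCoefficients.Default S using (solve; _:=_; _:+_; _:*_; con)
  open import Data.Fin using (toℕ)
  open import Data.Fin.Properties using (toℕ-fromℕ; toℕ-inject₁)
  open import Relation.Binary.Reasoning.Setoid setoid

  ι : ℕ → Carrier
  ι n = n × 1#

  ∑[≤_] : ℕ → (ℕ → Carrier) → Carrier
  ∑[≤ n ] f = sum {suc n} (λ j → f (toℕ j))

  ∑[≤]-cong : ∀ n {f g} → (∀ j → f j ≈ g j) → ∑[≤ n ] f ≈ ∑[≤ n ] g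
  ∑[≤]-cong n f≈g = sum-cong-≋ {suc n} (λ j → f≈g (toℕ j))

  ∑[≤]-+ : ∀ n f g → ∑[≤ n ] (λ j → f j + g j) ≈ ∑[≤ n ] f + ∑[≤ n ] g
  ∑[≤]-+ n f g = ∑-distrib-+ {suc n} (λ j → f (toℕ j)) (λ j → g (toℕ j))

  ∑[≤]-init-last : ∀ n f → ∑[≤ suc n ] f ≈ ∑[≤ n ] f + f (suc n)
  ∑[≤]-init-last n f = trans (sum-init-last {suc n} (λ j → f (toℕ j)))
    (+-cong (reflexive (sum-cong-≗ {suc n} (λ j → ≡.cong f (toℕ-inject₁ j))))
            (reflexive (≡.cong (λ k → f (suc k)) (toℕ-fromℕ n))))

  -- Both sides are the sum of f over 0 … n+1.
  ∑[≤]-shift : ∀ n f → f 0 ≈ 0# → f (suc n) ≈ 0# → ∑[≤ n ] f ≈ ∑[≤ n ] (λ j → f (suc j))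
  ∑[≤]-shift n f f0≈0 fn≈0 = begin
    ∑[≤ n ] f                           ≈⟨ +-identityʳ _ ⟨
    ∑[≤ n ] f + 0#                      ≈⟨ +-congˡ fn≈0 ⟨
    ∑[≤ n ] f + f (suc n)               ≈⟨ ∑[≤]-init-last n f ⟨
    f 0 + ∑[≤ n ] (λ j → f (suc j))     ≈⟨ +-congʳ f0≈0 ⟩
    0# + ∑[≤ n ] (λ j → f (suc j))      ≈⟨ +-identityˡ _ ⟩
    ∑[≤ n ] (λ j → f (suc j))           ∎

  Δ : (ℕ → Carrier) → ℕ → Carrier
  Δ g m = g (suc m) + ι m * g m

  Δⁿ : ℕ → (ℕ → Carrier) → ℕ → Carrier
  Δⁿ zero g = g
  Δⁿ (suc n) g = Δⁿ n (Δ g)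

  Δⁿ-cong : ∀ n {f g} → (∀ m → f m ≈ g m) → ∀ m → Δⁿ n f m ≈ Δⁿ n g m
  Δⁿ-cong zero f≈g = f≈g
  Δⁿ-cong (suc n) f≈g = Δⁿ-cong n (λ m → +-cong (f≈g (suc m)) (*-congˡ (f≈g m)))

  Δⁿ-linear : ∀ n f x g m → Δⁿ n (λ j → f j + x * g j) m ≈ Δⁿ n f m + x * Δⁿ n g m
  Δⁿ-linear zero f x g m = refl
  Δⁿ-linear (suc n) f x g m = trans (Δⁿ-cong n Δ-linear m) (Δⁿ-linear n (Δ f) x (Δ g) m)
    where
    Δ-linear : ∀ j → Δ (λ j → f j + x * g j) j ≈ Δ f j + x * Δ g j
    Δ-linear j = solve 6 (λ a x b i y z → (a :+ x :* b) :+ i :* (y :+ x :* z)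
                                        := (a :+ i :* y) :+ x :* (b :+ i :* z))
                         refl (f (suc j)) x (g (suc j)) (ι j) (f j) (g j)

  ι-S₂-suc : ∀ n j → ι (S₂ (suc n) (suc j)) ≈ ι (suc j) * ι (S₂ n (suc j)) + ι (S₂ n j)
  ι-S₂-suc n j = trans (×-homo-+ 1# (suc j ℕ.* S₂ n (suc j)) (S₂ n j))
                       (+-congʳ (×1-homo-* (suc j) (S₂ n (suc j))))

  Δⁿ-stirling : ∀ n g → Δⁿ n g 0 ≈ ∑[≤ n ] (λ j → ι (S₂ n j) * g j)
  Δⁿ-stirling zero g = solve 1 (λ x → x := (con 1 :+ con 0) :* x :+ con 0) refl (g 0)
  Δⁿ-stirling (suc n) g = begin
    Δⁿ n (Δ g) 0
      ≈⟨ Δⁿ-stirling n (Δ g) ⟩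
    ∑[≤ n ] (λ j → s j * (g (suc j) + ι j * g j))
      ≈⟨ ∑[≤]-cong n (λ j → distribˡ (s j) (g (suc j)) (ι j * g j)) ⟩
    ∑[≤ n ] (λ j → s j * g (suc j) + h j)
      ≈⟨ ∑[≤]-+ n (λ j → s j * g (suc j)) h ⟩
    ∑[≤ n ] (λ j → s j * g (suc j)) + ∑[≤ n ] h
      ≈⟨ +-congˡ (∑[≤]-shift n h h0≈0 hn≈0) ⟩
    ∑[≤ n ] (λ j → s j * g (suc j)) + ∑[≤ n ] (λ j → h (suc j))
      ≈⟨ ∑[≤]-+ n (λ j → s j * g (suc j)) (λ j → h (suc j)) ⟨
    ∑[≤ n ] (λ j → s j * g (suc j) + h (suc j))
      ≈⟨ ∑[≤]-cong n coefficient ⟩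
    ∑[≤ n ] (λ j → ι (S₂ (suc n) (suc j)) * g (suc j))
      ≈⟨ +-identityˡ _ ⟨
    0# + ∑[≤ n ] (λ j → ι (S₂ (suc n) (suc j)) * g (suc j))
      ≈⟨ +-congʳ (zeroˡ (g 0)) ⟨
    ∑[≤ suc n ] (λ j → ι (S₂ (suc n) j) * g j) ∎
    where
    s : ℕ → Carrier
    s j = ι (S₂ n j)
    h : ℕ → Carrier
    h j = s j * (ι j * g j)
    h0≈0 : h 0 ≈ 0#
    h0≈0 = trans (*-congˡ (zeroˡ (g 0))) (zeroʳ _)
    hn≈0 : h (suc n) ≈ 0#
    hn≈0 = trans (*-congʳ (reflexive (≡.cong ι (S₂-vanishes (ℕ.n<1+n n))))) (zeroˡ _)
    coefficient : ∀ j → s j * g (suc j) + h (suc j) ≈ ι (S₂ (suc n) (suc j)) * g (suc j)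
    coefficient j = begin
      s j * g (suc j) + s (suc j) * (ι (suc j) * g (suc j))
        ≈⟨ solve 4 (λ a x b i → a :* x :+ b :* (i :* x) := (i :* b :+ a) :* x)
                   refl (s j) (g (suc j)) (s (suc j)) (ι (suc j)) ⟩
      (ι (suc j) * s (suc j) + s j) * g (suc j)   ≈⟨ *-congʳ (ι-S₂-suc n j) ⟨
      ι (S₂ (suc n) (suc j)) * g (suc j)          ∎

module MeixnerMoments {c ℓ : Level} (R : CommutativeRing c ℓ) (b d : CommutativeRing.Carrier R) where
  open CommutativeRing R hiding (zero)
  open MeixnerRI R
  open import Algebra.Definitions.RawSemiring (Semiring.rawSemiring semiring) using (_^_)
  open import Algebra.Properties.Group +-group using (∙-cancelʳ)
  open import Data.List using (List; []; _∷_; map; _++_)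
  open StirlingTransform commutativeSemiring
    using (Δ; Δⁿ; Δⁿ-cong; Δⁿ-linear; Δⁿ-stirling; ∑[≤_]; ∑[≤]-cong; ∑[≤]-init-last)
  open IntegerCoefficientSolver R using (solve; _:=_; _:+_; _:*_; _:-_; con)
  open import Relation.Binary.Reasoning.Setoid setoid

  -- The recurrences below follow from instances u ≈ v of delannoy-exchange: adding v to the
  -- left and u to the right side leaves a polynomial identity, which the solver checks.
  ≈-by-balance : ∀ {x y u v} → u ≈ v → x + v ≈ y + u → x ≈ y
  ≈-by-balance {v = v} u≈v balanced = ∙-cancelʳ v _ _ (trans balanced (+-congˡ u≈v))

  -- delannoy m h = h! · Σ d ^ (number of steps), over the lattice paths from (0,0) to (m,h)
  -- with steps (1,0), (0,1) and (1,1).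
  delannoy : ℕ → ℕ → Carrier
  delannoy zero zero = 1#
  delannoy zero (suc h) = ι (suc h) * d * delannoy zero h
  delannoy (suc m) zero = d * delannoy m zero
  delannoy (suc m) (suc h) = d * (delannoy m (suc h) + ι (suc h) * (delannoy (suc m) h + delannoy m h))

  delannoy[m,0]≈d^m : ∀ m → delannoy m 0 ≈ d ^ m
  delannoy[m,0]≈d^m zero = refl
  delannoy[m,0]≈d^m (suc m) = *-congˡ (delannoy[m,0]≈d^m m)

  delannoy-exchange : ∀ m h → delannoy m (suc h) + ι h * delannoy m h
                             ≈ ι (suc m) * delannoy (suc m) h + ι m * delannoy m h
  delannoy-exchange zero zero = +-congʳ (*-assoc _ _ _)
  delannoy-exchange zero (suc h) = ≈-by-balance (*-congˡ (delannoy-exchange zero h))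
    (solve 4 (λ d h x y →
       let one = con (+ 1) ; zr = con (+ 0) ; H = one :+ h in
       (one :+ H) :* d :* (H :* d :* x) :+ H :* (H :* d :* x) :+ H :* d :* ((one :+ zr) :* y :+ zr :* x)
       := (one :+ zr) :* (d :* (H :* d :* x :+ H :* (y :+ x))) :+ zr :* (H :* d :* x)
          :+ H :* d :* (H :* d :* x :+ h :* x))
      refl d (ι h) (delannoy 0 h) (delannoy 1 h))
  delannoy-exchange (suc m) zero = ≈-by-balance (*-congˡ (delannoy-exchange m zero))
    (solve 4 (λ d m y z →
       let one = con (+ 1) ; zr = con (+ 0) ; M = one :+ m in
       d :* (z :+ (one :+ zr) :* (d :* y :+ y)) :+ zr :* (d :* y) :+ d :* (M :* (d :* y) :+ m :* y)
       := (one :+ M) :* (d :* (d :* y)) :+ M :* (d :* y) :+ d :* (z :+ zr :* y))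
      refl d (ι m) (delannoy m 0) (delannoy m 1))
  delannoy-exchange (suc m) (suc h) = ≈-by-balance
    (*-congˡ (+-cong (delannoy-exchange m (suc h))
                     (*-congˡ (+-cong (delannoy-exchange (suc m) h) (delannoy-exchange m h)))))
    (solve 8 (λ d m h x₁ x₂ x₃ x₄ x₅ →
       let one = con (+ 1) ; M = one :+ m ; H = one :+ h
           y = d :* (x₂ :+ H :* (x₃ :+ x₄))
       in d :* (x₁ :+ (one :+ H) :* (y :+ x₂)) :+ H :* y
            :+ d :* (M :* y :+ m :* x₂ :+ H :* ((one :+ M) :* x₅ :+ M :* x₃ :+ (M :* x₃ :+ m :* x₄)))
          := (one :+ M) :* (d :* (y :+ H :* (x₅ :+ x₃))) :+ M :* y
            :+ d :* (x₁ :+ H :* x₂ :+ H :* (y :+ h :* x₃ :+ (x₂ :+ h :* x₄))))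
      refl d (ι m) (ι h) (delannoy m (suc (suc h))) (delannoy m (suc h)) (delannoy (suc m) h)
           (delannoy m h) (delannoy (suc (suc m)) h))

  risingDelannoy : ℕ → ℕ → Carrier
  risingDelannoy h m = rising b d m * delannoy m h

  Δ-risingDelannoy-zero : ∀ m → Δ (risingDelannoy 0) m
                                 ≈ risingDelannoy 1 m + bₙ b d 0 * risingDelannoy 0 m
  Δ-risingDelannoy-zero m = ≈-by-balance (*-congˡ (sym (delannoy-exchange m 0)))
    (solve 6 (λ r b d m y z →
       let one = con (+ 1) ; zr = con (+ 0) in
       r :* (b :+ m) :* (d :* y) :+ m :* (r :* y) :+ r :* (z :+ zr :* y)
       := r :* z :+ (zr :- d :* zr :+ b :* d :- d) :* (r :* y) :+ r :* ((one :+ m) :* (d :* y) :+ m :* y))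
      refl (rising b d m) b d (ι m) (delannoy m 0) (delannoy m 1))

  Δ-risingDelannoy-suc : ∀ m h →
    Δ (risingDelannoy (suc h)) m
      ≈ risingDelannoy (suc (suc h)) m + bₙ b d (suc h) * risingDelannoy (suc h) m
        + aₙ b d (suc h) * Δ (risingDelannoy h) m + λₙ b d (suc h) * risingDelannoy h m
  Δ-risingDelannoy-suc m h = ≈-by-balance
    (*-congˡ (+-cong (sym (delannoy-exchange m (suc h))) (*-congˡ (delannoy-exchange m h))))
    (solve 9 (λ r b d m h x₁ x₂ x₃ x₄ →
       let one = con (+ 1) ; M = one :+ m ; H = one :+ h
           y = d :* (x₂ :+ H :* (x₃ :+ x₄))
       in r :* (b :+ m) :* y :+ m :* (r :* x₂) :+ r :* (x₁ :+ H :* x₂ :+ d :* H :* (M :* x₃ :+ m :* x₄))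
          := r :* x₁ :+ (H :- d :* H :+ b :* d :- d) :* (r :* x₂)
             :+ H :* d :* (r :* (b :+ m) :* x₃ :+ m :* (r :* x₄)) :+ (b :* d :* H :- d :* (H :* H)) :* (r :* x₄)
             :+ r :* (M :* y :+ m :* x₂ :+ d :* H :* (x₂ :+ h :* x₄)))
      refl (rising b d m) b d (ι m) (ι h)
           (delannoy m (suc (suc h))) (delannoy m (suc h)) (delannoy (suc m) h) (delannoy m h))

  weightSum : ∀ {k h} → List (MSPath k h) → Carrier
  weightSum ps = sumR b d (map (weight b d) ps)

  weightSum-++ : ∀ {k h} (ps qs : List (MSPath k h)) → weightSum (ps ++ qs) ≈ weightSum ps + weightSum qs
  weightSum-++ [] qs = sym (+-identityˡ _)
  weightSum-++ (p ∷ ps) qs = trans (+-congˡ (weightSum-++ ps qs)) (sym (+-assoc _ _ _))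

  weightSum-map : ∀ {k h k′ h′} (step : MSPath k h → MSPath k′ h′) x →
                  (∀ p → weight b d (step p) ≈ x * weight b d p) →
                  ∀ ps → weightSum (map step ps) ≈ x * weightSum ps
  weightSum-map step x step-weight [] = sym (zeroʳ x)
  weightSum-map step x step-weight (p ∷ ps) =
    trans (+-cong (step-weight p) (weightSum-map step x step-weight ps)) (sym (distribˡ x _ _))

  pathSum : ℕ → ℕ → Carrier
  pathSum k h = weightSum (allPaths k h)

  pathSum-suc-zero : ∀ k → pathSum (suc k) 0 ≈ pathSum k 1 + bₙ b d 0 * pathSum k 0
  pathSum-suc-zero k = begin
    weightSum (map up (allPaths k 1) ++ map hor (allPaths k 0))
      ≈⟨ weightSum-++ (map up (allPaths k 1)) _ ⟩
    weightSum (map up (allPaths k 1)) + weightSum (map hor (allPaths k 0))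
      ≈⟨ +-cong (weightSum-map up 1# (λ _ → sym (*-identityˡ _)) (allPaths k 1))
                (weightSum-map hor (bₙ b d 0) (λ _ → refl) (allPaths k 0)) ⟩
    1# * pathSum k 1 + bₙ b d 0 * pathSum k 0
      ≈⟨ +-congʳ (*-identityˡ _) ⟩
    pathSum k 1 + bₙ b d 0 * pathSum k 0 ∎

  pathSum-suc-suc : ∀ k h →
    pathSum (suc k) (suc h)
      ≈ pathSum k (suc (suc h)) + bₙ b d (suc h) * pathSum k (suc h)
        + aₙ b d (suc h) * pathSum (suc k) h + λₙ b d (suc h) * pathSum k h
  pathSum-suc-suc k h = begin
    weightSum (ups ++ hors ++ verts ++ diags)
      ≈⟨ trans (weightSum-++ ups _)
               (+-congˡ (trans (weightSum-++ hors _) (+-congˡ (weightSum-++ verts diags)))) ⟩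
    weightSum ups + (weightSum hors + (weightSum verts + weightSum diags))
      ≈⟨ +-cong (weightSum-map up 1# (λ _ → sym (*-identityˡ _)) (allPaths k (suc (suc h))))
         (+-cong (weightSum-map hor (bₙ b d (suc h)) (λ _ → refl) (allPaths k (suc h)))
         (+-cong (weightSum-map vert (aₙ b d (suc h)) (λ _ → refl) (allPaths (suc k) h))
                 (weightSum-map diag (λₙ b d (suc h)) (λ _ → refl) (allPaths k h)))) ⟩
    1# * pathSum k (suc (suc h)) + (β * pathSum k (suc h) + (α * pathSum (suc k) h + λ′ * pathSum k h))
      ≈⟨ solve 7 (λ u v w z β α λ′ → con (+ 1) :* u :+ (β :* v :+ (α :* w :+ λ′ :* z))
                                     := u :+ β :* v :+ α :* w :+ λ′ :* z)
               refl (pathSum k (suc (suc h))) (pathSum k (suc h)) (pathSum (suc k) h) (pathSum k h) β α λ′ ⟩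
    pathSum k (suc (suc h)) + β * pathSum k (suc h) + α * pathSum (suc k) h + λ′ * pathSum k h ∎
    where
    ups hors verts diags : List (MSPath (suc k) (suc h))
    ups = map up (allPaths k (suc (suc h)))
    hors = map hor (allPaths k (suc h))
    verts = map vert (allPaths (suc k) h)
    diags = map diag (allPaths k h)
    β α λ′ : Carrier
    β = bₙ b d (suc h)
    α = aₙ b d (suc h)
    λ′ = λₙ b d (suc h)

  pathSum≈Δⁿ : ∀ k h → pathSum k h ≈ Δⁿ k (risingDelannoy h) 0
  pathSum≈Δⁿ zero zero = trans (+-identityʳ 1#) (sym (*-identityˡ 1#))
  pathSum≈Δⁿ zero (suc h) = begin
    pathSum 0 (suc h)                                  ≈⟨ weightSum-map vert α (λ _ → refl) (allPaths 0 h) ⟩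
    α * pathSum 0 h                                    ≈⟨ *-congˡ (pathSum≈Δⁿ zero h) ⟩
    α * (1# * delannoy 0 h)                            ≈⟨ *-congˡ (*-identityˡ _) ⟩
    α * delannoy 0 h                                   ≈⟨ *-identityˡ _ ⟨
    1# * delannoy 0 (suc h)                            ∎
    where
    α : Carrier
    α = aₙ b d (suc h)
  pathSum≈Δⁿ (suc k) zero = begin
    pathSum (suc k) 0
      ≈⟨ pathSum-suc-zero k ⟩
    pathSum k 1 + β * pathSum k 0
      ≈⟨ +-cong (pathSum≈Δⁿ k 1) (*-congˡ (pathSum≈Δⁿ k 0)) ⟩
    Δⁿ k (G 1) 0 + β * Δⁿ k (G 0) 0
      ≈⟨ Δⁿ-linear k (G 1) β (G 0) 0 ⟨
    Δⁿ k (λ m → G 1 m + β * G 0 m) 0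
      ≈⟨ Δⁿ-cong k (λ m → sym (Δ-risingDelannoy-zero m)) 0 ⟩
    Δⁿ k (Δ (G 0)) 0 ∎
    where
    β : Carrier
    β = bₙ b d 0
    G : ℕ → ℕ → Carrier
    G = risingDelannoy
  pathSum≈Δⁿ (suc k) (suc h) = begin
    pathSum (suc k) (suc h)
      ≈⟨ pathSum-suc-suc k h ⟩
    pathSum k (suc (suc h)) + β * pathSum k (suc h) + α * pathSum (suc k) h + λ′ * pathSum k h
      ≈⟨ +-cong (+-cong (+-cong (pathSum≈Δⁿ k (suc (suc h))) (*-congˡ (pathSum≈Δⁿ k (suc h))))
                        (*-congˡ (pathSum≈Δⁿ (suc k) h)))
                (*-congˡ (pathSum≈Δⁿ k h)) ⟩
    Δⁿ k (G (suc (suc h))) 0 + β * Δⁿ k (G (suc h)) 0 + α * Δⁿ k (Δ (G h)) 0 + λ′ * Δⁿ k (G h) 0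
      ≈⟨ trans (Δⁿ-linear k _ λ′ (G h) 0)
               (+-congʳ (trans (Δⁿ-linear k _ α (Δ (G h)) 0)
                               (+-congʳ (Δⁿ-linear k (G (suc (suc h))) β (G (suc h)) 0)))) ⟨
    Δⁿ k (λ m → G (suc (suc h)) m + β * G (suc h) m + α * Δ (G h) m + λ′ * G h m) 0
      ≈⟨ Δⁿ-cong k (λ m → sym (Δ-risingDelannoy-suc m h)) 0 ⟩
    Δⁿ k (Δ (G (suc h))) 0 ∎
    where
    β α λ′ : Carrier
    β = bₙ b d (suc h)
    α = aₙ b d (suc h)
    λ′ = λₙ b d (suc h)
    G : ℕ → ℕ → Carrier
    G = risingDelannoy

  Σ₁-extend : ∀ n f → f 0 + Σ₁ b d n f ≈ ∑[≤ n ] f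
  Σ₁-extend zero f = refl
  Σ₁-extend (suc n) f = begin
    f 0 + (Σ₁ b d n f + f (suc n))      ≈⟨ +-assoc _ _ _ ⟨
    f 0 + Σ₁ b d n f + f (suc n)        ≈⟨ +-congʳ (Σ₁-extend n f) ⟩
    ∑[≤ n ] f + f (suc n)               ≈⟨ ∑[≤]-init-last n f ⟨
    ∑[≤ suc n ] f                       ∎

  μ≈rhs : ∀ n → μ b d (suc n) ≈ rhs b d (suc n)
  μ≈rhs n = begin
    μ b d (suc n)                                             ≈⟨ pathSum≈Δⁿ (suc n) 0 ⟩
    Δⁿ (suc n) (risingDelannoy 0) 0                           ≈⟨ Δⁿ-stirling (suc n) (risingDelannoy 0) ⟩
    ∑[≤ suc n ] (λ j → ι (S₂ (suc n) j) * risingDelannoy 0 j) ≈⟨ ∑[≤]-cong (suc n) term ⟩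
    ∑[≤ suc n ] t                                             ≈⟨ Σ₁-extend (suc n) t ⟨
    t 0 + rhs b d (suc n)                                     ≈⟨ +-congʳ t0≈0 ⟩
    0# + rhs b d (suc n)                                      ≈⟨ +-identityˡ _ ⟩
    rhs b d (suc n)                                           ∎
    where
    t : ℕ → Carrier
    t j = ι (S₂ (suc n) j) * rising b d j * d ^ j
    term : ∀ j → ι (S₂ (suc n) j) * risingDelannoy 0 j ≈ t j
    term j = trans (sym (*-assoc _ _ _)) (*-congˡ (delannoy[m,0]≈d^m j))
    t0≈0 : t 0 ≈ 0#
    t0≈0 = trans (*-congʳ (zeroˡ _)) (zeroˡ _)

proposition10p7 : ∀ {c ℓ : Level} (R : CommutativeRing c ℓ) (b d : CommutativeRing.Carrier R) (n : ℕ) →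
    n ≥ 1 → CommutativeRing._≈_ R (MeixnerRI.μ R b d n) (MeixnerRI.rhs R b d n)
proposition10p7 R b d (suc n) _ = MeixnerMoments.μ≈rhs R b d n
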